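{- Let $G$ be a connected co-biconvex graph with $\delta(G)\geq 2$, let $U$ be its set of universal vertices, and let $\alpha_1,\alpha_2$ be the independence numbers of the auxiliary interval graphs $H_1,H_2$ of $G-U$ described in the context. Then: (i) if $|U|=1$, then $\gamma_{\times 3}(G)=4$ if $\alpha_1+\alpha_2\geq 3$, and $\gamma_{\times 3}(G)=5$ if $\alpha_1+\alpha_2=2$; (ii) if $|U|=2$ then $\gamma_{\times 3}(G)=4$; (iii) if $|U|\geq 3$ then $\gamma_{\times 3}(G)=3$; (iv) if $|U|=0$ and $\alpha_1+\alpha_2\geq 4$ then $\gamma_{\times 3}(G)=4$; (v) if $|U|=0$ and $\alpha_1=\alpha_2=1$ then $\gamma_{\times 3}(G)=6$; (vi) if $|U|=0$ and $\alpha_1+\alpha_2=3$ then $\gamma_{\times 3}(G)=5$.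
   Context: For a graph $G$ with vertices $v_1,\dots,v_n$, $M^*(G)$ is the $0,1$-matrix with entry $(i,j)=1$ iff $i=j$ or $v_iv_j\in E(G)$. $G$ is co-biconvex if the rows of $M^*(G)$ can be permuted so the 0's in every column are consecutive. A vertex is universal if adjacent to all others; $U$ is the set of universal vertices, and $G-U$ is co-biconvex without universal vertices. For a co-biconvex graph $G'$ without universal vertices: fix an ordering $v_1,\dots,v_n$ (rows and columns of $M^*(G')$ in this order) in which the 0's of each column are consecutive; $C_1$ is the set of vertices whose column has its 0's below the diagonal and $C_2$ those whose column has its 0's above; they partition $V(G')$, are cliques, and we may take $C_1=\{v_1,\dots,v_r\}$, $C_2=\{v_{r+1},\dots,v_n\}$. For $v_i\in C_1$ (resp. $C_2$), if the 0's of column $i$ occupy rows $p,\dots,p+s$, set $I_i=[p,p+s]$. $H_1$ is the intersection graph of $\{I_i:v_i\in C_1\}$ and $H_2$ of $\{I_i:v_i\in C_2\}$; equivalently, two vertices of $C_1$ are adjacent in $H_1$ iff some vertex of $C_2$ is non-adjacent to both (symmetrically for $H_2$). $\delta(G)$ is the minimum degree, $N_G[v]$ the closed neighborhood; $D$ is a $k$-tuple dominating set if $|N_G[v]\cap D|\geq k$ for all $v$; $\gamma_{\times k}(G)$ is the minimum size of such a set. -}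

module Defs where

open import Data.Nat using (ℕ; _≤_)
open import Data.Fin using (Fin; _≟_) renaming (_≤_ to _≤ᶠ_; _<_ to _<ᶠ_; _>_ to _>ᶠ_)
open import Data.Fin.Properties using (all?)
open import Data.Fin.Subset using (Subset; _∈_; _∩_; ∣_∣)
open import Data.Fin.Permutation using (Permutation′; _⟨$⟩ʳ_; _⟨$⟩ˡ_)
open import Data.Bool using (Bool; true; false; _∨_)
import Data.Bool as B
open import Data.Vec using (tabulate)
open import Data.Product using (Σ; _×_; ∃)
open import Relation.Nullary using (¬_)
open import Relation.Nullary.Decidable using (⌊_⌋)
open import Relation.Binary.PropositionalEquality using (_≡_; _≢_)

record Graph (n : ℕ) : Set where
  field
    adj        : Fin n → Fin n → Bool
    adj-sym    : ∀ i j → adj i j ≡ adj j i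
    adj-irrefl : ∀ i → adj i i ≡ false
open Graph public

module _ {n : ℕ} (G : Graph n) where

  M* : Fin n → Fin n → Bool
  M* i j = ⌊ i ≟ j ⌋ ∨ adj G i j

  nbhd : Fin n → Subset n
  nbhd v = tabulate (adj G v)

  closedNbhd : Fin n → Subset n
  closedNbhd v = tabulate (M* v)

  degree : Fin n → ℕ
  degree v = ∣ nbhd v ∣

  MinDegree≥ : ℕ → Set
  MinDegree≥ k = ∀ v → k ≤ degree v

  data Reachable : Fin n → Fin n → Set where
    here : ∀ {v} → Reachable v v
    step : ∀ {u v w} → adj G u v ≡ true → Reachable v w → Reachable u w

  Connected : Set
  Connected = ∀ u v → Reachable u v

  Universal : Fin n → Set
  Universal v = ∀ w → M* v w ≡ true

  universalSet : Subset n
  universalSet = tabulate (λ v → ⌊ all? (λ w → M* v w B.≟ true) ⌋)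

  -- G is co-biconvex: some permutation σ of the rows of M*(G) (row at position p
  -- is the row of vertex σ p) makes the 0's of every column consecutive.
  IsCoBiconvex : Set
  IsCoBiconvex = Σ (Permutation′ n) λ σ →
    ∀ j p q r → p ≤ᶠ q → q ≤ᶠ r →
      M* (σ ⟨$⟩ʳ p) j ≡ false → M* (σ ⟨$⟩ʳ r) j ≡ false → M* (σ ⟨$⟩ʳ q) j ≡ false

  -- An ordering of the vertices of G - U (vertex σ p sits at position p; the
  -- universal vertices are ignored) in which, in M*(G - U), the 0's of every
  -- column are consecutive.
  CoBiconvexOrderingMinusU : Permutation′ n → Set
  CoBiconvexOrderingMinusU σ =
    ∀ j → ¬ Universal j → ∀ p q r →
      ¬ Universal (σ ⟨$⟩ʳ p) → ¬ Universal (σ ⟨$⟩ʳ q) → ¬ Universal (σ ⟨$⟩ʳ r) →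
      p ≤ᶠ q → q ≤ᶠ r →
      M* (σ ⟨$⟩ʳ p) j ≡ false → M* (σ ⟨$⟩ʳ r) j ≡ false → M* (σ ⟨$⟩ʳ q) j ≡ false

  module _ (σ : Permutation′ n) where

    pos : Fin n → Fin n
    pos v = σ ⟨$⟩ˡ v

    -- C₁: vertices of G - U whose column has its 0's below the diagonal
    C₁ : Fin n → Set
    C₁ v = ¬ Universal v × (∀ w → ¬ Universal w → M* w v ≡ false → pos w >ᶠ pos v)

    -- C₂: vertices of G - U whose column has its 0's above the diagonal
    C₂ : Fin n → Set
    C₂ v = ¬ Universal v × (∀ w → ¬ Universal w → M* w v ≡ false → pos w <ᶠ pos v)

    -- I_u ∩ I_v ≠ ∅, where I_v is the set of row positions (rows of G - U)
    -- holding a 0 in column v.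
    IntervalsMeet : Fin n → Fin n → Set
    IntervalsMeet u v = ∃ λ p → ¬ Universal (σ ⟨$⟩ʳ p) ×
      M* (σ ⟨$⟩ʳ p) u ≡ false × M* (σ ⟨$⟩ʳ p) v ≡ false

    -- independent sets of the intersection graph of {I_v : v ∈ C}
    IndependentIn : (Fin n → Set) → Subset n → Set
    IndependentIn C S = (∀ v → v ∈ S → C v) ×
      (∀ u v → u ∈ S → v ∈ S → u ≢ v → ¬ IntervalsMeet u v)

    IsIndependenceNumber : (Fin n → Set) → ℕ → Set
    IsIndependenceNumber C α =
      (Σ (Subset n) λ S → IndependentIn C S × ∣ S ∣ ≡ α) ×
      (∀ S → IndependentIn C S → ∣ S ∣ ≤ α)

  IsKTupleDominating : ℕ → Subset n → Set
  IsKTupleDominating k D = ∀ v → k ≤ ∣ closedNbhd v ∩ D ∣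

  IsKTupleDomNumber : ℕ → ℕ → Set
  IsKTupleDomNumber k γ =
    (Σ (Subset n) λ D → IsKTupleDominating k D × ∣ D ∣ ≡ γ) ×
    (∀ D → IsKTupleDominating k D → γ ≤ ∣ D ∣)

-- Say that v misses the vertices of D outside N[v]; D is 3-tuple dominating iff every vertex
-- misses at most |D| − 3 of them. Lower bounds: if |D| ≤ 3 nothing is missed, so D ⊆ U; if
-- |D| ≤ 4 no vertex misses two vertices of D, so D ∩ Cᵢ is independent in Hᵢ and
-- |D| ≤ |U| + α₁ + α₂; if |D| ≤ 5 and Hᵢ is complete, Helly's property for the intervals Iᵥ
-- gives |D ∩ Cᵢ| ≤ 2. Upper bounds: in U ∪ S₁ ∪ S₂, with Sᵢ a maximum independent set of Hᵢ,
-- every vertex misses at most one element, so any four of them are 3-tuple dominating (any three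
-- vertices of U if |U| ≥ 3). In the remaining cases C₁ and C₂ are cliques, so a vertex sees every
-- chosen vertex of its own class, and δ(G) ≥ 2 supplies two or three vertices in each class.
module Submission where

open import Defs
open import Data.Nat using (ℕ; zero; suc; _+_; _≤_; _<_; z≤n; s≤s; _≤?_; _<?_)
open import Data.Nat.Properties
  using (≤-trans; ≤-reflexive; ≤-refl; +-suc; +-identityʳ; module ≤-Reasoning; +-mono-≤; +-monoˡ-≤; +-monoʳ-≤; ≤-pred; ≰⇒>; ≮⇒≥; <⇒≱; ≤-antisym; +-cancelˡ-≤; +-cancelʳ-≤; <⇒≤; ≤∧≢⇒<; <-irrefl; m≤m+n)
open import Data.Fin using (Fin; zero; suc; _≟_)
  renaming (_≤_ to _≤ᶠ_; _<_ to _<ᶠ_; _>_ to _>ᶠ_)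
open import Data.Fin.Properties using (all?; any?; ¬∀⟶∃¬)
  renaming (_<?_ to _<ᶠ?_; <-cmp to <ᶠ-cmp; <-asym to <ᶠ-asym; ≤-total to ≤ᶠ-total)
open import Data.Fin.Permutation using (Permutation′; _⟨$⟩ʳ_; inverseʳ)
open import Data.Fin.Subset
  using (Subset; _∈_; _∉_; _⊆_; _∩_; _∪_; _─_; _-_; ⁅_⁆; ∣_∣; Nonempty; inside; outside)
  renaming (⊥ to ∅)
open import Data.Fin.Subset.Properties
  using (⊥⊆; ∣⊥∣≡0; ∣⁅x⁆∣≡1; x∈⁅x⁆; x∈⁅y⁆⇒x≡y; x∉⁅y⁆⇒x≢y; nonempty?; Empty-unique;
         p⊆q⇒∣p∣≤∣q∣; ∣p∩q∣≤∣p∣; ∣p∩q∣≤∣q∣; x∈p∪q⁺; x∈p∪q⁻; x∈p∩q⁺; x∈p∩q⁻; p─q⊆p; x∈p∧x∉q⇒x∈p─q; x∈p∧x≢y⇒x∈p-y;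
         x∈p⇒∣p-x∣<∣p∣; s⊆s)
open import Data.Bool using (Bool; true; false)
import Data.Bool as B
open import Data.Bool.Properties using (∨-zeroʳ; ¬-not)
open import Data.Vec using ([]; _∷_; here; there; tabulate)
open import Data.Vec.Properties using (lookup∘tabulate; lookup⇒[]=; []=⇒lookup)
open import Data.List using (List; []; _∷_; length; foldr)
open import Data.List.Relation.Unary.Any using (here; there)
open import Data.List.Membership.Propositional using () renaming (_∈_ to _∈ₗ_)
open import Data.Product using (∃; _×_; _,_; proj₁; proj₂)
open import Data.Sum using (_⊎_; inj₁; inj₂)
import Data.Sum as Sum
open import Relation.Binary using (tri<; tri≈; tri>)
open import Relation.Nullary using (¬_; Dec; yes; no; contradiction)
open import Relation.Nullary.Decidable using (⌊_⌋; dec-true; isYes≗does; ¬?; _×-dec_; _→-dec_)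
open import Relation.Unary using (Pred; Decidable)
open import Level using (0ℓ)
open import Function using (_∘_)
open import Data.Empty using (⊥; ⊥-elim)
open import Relation.Binary.PropositionalEquality using (_≡_; _≢_; refl; sym; trans; cong; cong₂; subst; module ≡-Reasoning)

pattern ∈₀ = here refl
pattern ∈₁ = there ∈₀
pattern ∈₂ = there ∈₁
pattern ∈₃ = there ∈₂
pattern ∈₄ = there ∈₃
pattern ∈₅ = there ∈₄

private
  variable
    n k m : ℕ
    p q : Subset n
    x y z : Fin n

≤-refine : ∀ {k x} → k ≤ x → (x ≤ k → x < k) → k < x
≤-refine k≤x small = ≤∧≢⇒< k≤x λ { refl → <-irrefl refl (small ≤-refl) }

split-3 : ∀ {a b} → a + b ≡ 3 → 1 ≤ a → 1 ≤ b → (2 ≤ a × b ≤ 1) ⊎ (a ≤ 1 × 2 ≤ b)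
split-3 {zero}                   _    ()  _
split-3 {1}                      refl _   _  = inj₂ (≤-refl , ≤-refl)
split-3 {2}                      refl _   _  = inj₁ (≤-refl , ≤-refl)
split-3 {3}                      refl _   ()
split-3 {suc (suc (suc (suc _)))} ()  _   _

∣q∣≡∣p∩q∣+∣q─p∣ : ∀ (p q : Subset n) → ∣ q ∣ ≡ ∣ p ∩ q ∣ + ∣ q ─ p ∣
∣q∣≡∣p∩q∣+∣q─p∣ []            []            = refl
∣q∣≡∣p∩q∣+∣q─p∣ (inside  ∷ p) (inside  ∷ q) = cong suc (∣q∣≡∣p∩q∣+∣q─p∣ p q)
∣q∣≡∣p∩q∣+∣q─p∣ (inside  ∷ p) (outside ∷ q) = ∣q∣≡∣p∩q∣+∣q─p∣ p q
∣q∣≡∣p∩q∣+∣q─p∣ (outside ∷ p) (inside  ∷ q) =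
  trans (cong suc (∣q∣≡∣p∩q∣+∣q─p∣ p q)) (sym (+-suc _ _))
∣q∣≡∣p∩q∣+∣q─p∣ (outside ∷ p) (outside ∷ q) = ∣q∣≡∣p∩q∣+∣q─p∣ p q

∣p∪q∣+∣p∩q∣≡∣p∣+∣q∣ : ∀ (p q : Subset n) → ∣ p ∪ q ∣ + ∣ p ∩ q ∣ ≡ ∣ p ∣ + ∣ q ∣
∣p∪q∣+∣p∩q∣≡∣p∣+∣q∣ []            []            = refl
∣p∪q∣+∣p∩q∣≡∣p∣+∣q∣ (inside  ∷ p) (inside  ∷ q) =
  cong suc (trans (+-suc _ _) (trans (cong suc (∣p∪q∣+∣p∩q∣≡∣p∣+∣q∣ p q)) (sym (+-suc _ _))))
∣p∪q∣+∣p∩q∣≡∣p∣+∣q∣ (inside  ∷ p) (outside ∷ q) = cong suc (∣p∪q∣+∣p∩q∣≡∣p∣+∣q∣ p q)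
∣p∪q∣+∣p∩q∣≡∣p∣+∣q∣ (outside ∷ p) (inside  ∷ q) =
  trans (cong suc (∣p∪q∣+∣p∩q∣≡∣p∣+∣q∣ p q)) (sym (+-suc _ _))
∣p∪q∣+∣p∩q∣≡∣p∣+∣q∣ (outside ∷ p) (outside ∷ q) = ∣p∪q∣+∣p∩q∣≡∣p∣+∣q∣ p q

∣p∪q∣≤∣p∣+∣q∣ : ∀ (p q : Subset n) → ∣ p ∪ q ∣ ≤ ∣ p ∣ + ∣ q ∣
∣p∪q∣≤∣p∣+∣q∣ p q = ≤-trans (m≤m+n _ _) (≤-reflexive (∣p∪q∣+∣p∩q∣≡∣p∣+∣q∣ p q))

Empty⇒∣p∣≡0 : ¬ Nonempty p → ∣ p ∣ ≡ 0
Empty⇒∣p∣≡0 {n} empty rewrite Empty-unique empty = ∣⊥∣≡0 n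

disjoint⇒∣p∪q∣≡∣p∣+∣q∣ : ∀ (p q : Subset n) → (∀ {x} → x ∈ p → x ∉ q) → ∣ p ∪ q ∣ ≡ ∣ p ∣ + ∣ q ∣
disjoint⇒∣p∪q∣≡∣p∣+∣q∣ p q disjoint = begin
  ∣ p ∪ q ∣               ≡⟨ sym (+-identityʳ _) ⟩
  ∣ p ∪ q ∣ + 0           ≡⟨ cong (∣ p ∪ q ∣ +_) (sym (Empty⇒∣p∣≡0 p∩q-empty)) ⟩
  ∣ p ∪ q ∣ + ∣ p ∩ q ∣   ≡⟨ ∣p∪q∣+∣p∩q∣≡∣p∣+∣q∣ p q ⟩
  ∣ p ∣ + ∣ q ∣           ∎
  where
  open ≡-Reasoning
  p∩q-empty : ¬ Nonempty (p ∩ q)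
  p∩q-empty (x , x∈p∩q) = let x∈p , x∈q = x∈p∩q⁻ p q x∈p∩q in disjoint x∈p x∈q

x∈p─q⇒x∉q : x ∈ p ─ q → x ∉ q
x∈p─q⇒x∉q {p = _ ∷ p} {q = outside ∷ q} here        ()
x∈p─q⇒x∉q {p = _ ∷ p} {q = _       ∷ q} (there x∈) (there x∈q) = x∈p─q⇒x∉q x∈ x∈q

x∈p-y⁻ : x ∈ p - y → x ∈ p × x ≢ y
x∈p-y⁻ {p = p} {y = y} x∈ = p─q⊆p p ⁅ y ⁆ x∈ , x∉⁅y⁆⇒x≢y (x∈p─q⇒x∉q x∈)

∣p∣≤1+∣p-x∣ : ∀ (p : Subset n) x → ∣ p ∣ ≤ suc ∣ p - x ∣
∣p∣≤1+∣p-x∣ p x = begin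
  ∣ p ∣                         ≡⟨ ∣q∣≡∣p∩q∣+∣q─p∣ ⁅ x ⁆ p ⟩
  ∣ ⁅ x ⁆ ∩ p ∣ + ∣ p - x ∣     ≤⟨ +-monoˡ-≤ _ (∣p∩q∣≤∣p∣ ⁅ x ⁆ p) ⟩
  ∣ ⁅ x ⁆ ∣ + ∣ p - x ∣         ≡⟨ cong (_+ ∣ p - x ∣) (∣⁅x⁆∣≡1 x) ⟩
  suc ∣ p - x ∣                 ∎
  where open ≤-Reasoning

pick : suc k ≤ ∣ p ∣ → ∃ λ x → x ∈ p × k ≤ ∣ p - x ∣
pick {p = p} k<∣p∣ with nonempty? p
... | yes (x , x∈p) = x , x∈p , ≤-pred (≤-trans k<∣p∣ (∣p∣≤1+∣p-x∣ p x))
... | no empty with () ← ≤-trans k<∣p∣ (≤-reflexive (Empty⇒∣p∣≡0 empty))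

pick-two : 2 ≤ ∣ p ∣ → ∃ λ x → ∃ λ y → x ∈ p × y ∈ p × x ≢ y
pick-two {p = p} 2≤∣p∣ with pick {p = p} 2≤∣p∣
... | x , x∈p , 1≤∣p-x∣ with pick {p = p - x} 1≤∣p-x∣
... | y , y∈p-x , _ = let y∈p , y≢x = x∈p-y⁻ y∈p-x in x , y , x∈p , y∈p , y≢x ∘ sym

pick-≢ : 2 ≤ ∣ p ∣ → ∀ y → ∃ λ x → x ∈ p × x ≢ y
pick-≢ {p = p} 2≤∣p∣ y with pick {p = p - y} (≤-pred (≤-trans 2≤∣p∣ (∣p∣≤1+∣p-x∣ p y)))
... | x , x∈p-y , _ = x , x∈p-y⁻ x∈p-y

∈⇒suc≤ : x ∈ p → k ≤ ∣ p - x ∣ → suc k ≤ ∣ p ∣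
∈⇒suc≤ x∈p k≤ = ≤-trans (s≤s k≤) (x∈p⇒∣p-x∣<∣p∣ x∈p)

two-distinct⇒2≤ : x ∈ p → y ∈ p → x ≢ y → 2 ≤ ∣ p ∣
two-distinct⇒2≤ x∈p y∈p x≢y =
  ∈⇒suc≤ x∈p (∈⇒suc≤ (x∈p∧x≢y⇒x∈p-y y∈p (x≢y ∘ sym)) z≤n)

three-distinct⇒3≤ : x ∈ p → y ∈ p → z ∈ p → x ≢ y → x ≢ z → y ≢ z → 3 ≤ ∣ p ∣
three-distinct⇒3≤ x∈p y∈p z∈p x≢y x≢z y≢z =
  ∈⇒suc≤ x∈p (two-distinct⇒2≤ (x∈p∧x≢y⇒x∈p-y y∈p (x≢y ∘ sym)) (x∈p∧x≢y⇒x∈p-y z∈p (x≢z ∘ sym)) y≢z)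

subset-of-size : ∀ (p : Subset n) → k ≤ ∣ p ∣ → ∃ λ q → q ⊆ p × ∣ q ∣ ≡ k
subset-of-size {n} {zero} p _ = ∅ , ⊥⊆ , ∣⊥∣≡0 n
subset-of-size {k = suc k} (inside  ∷ p) k≤ with subset-of-size p (≤-pred k≤)
... | q , q⊆p , ∣q∣≡k = inside ∷ q , s⊆s q⊆p , cong suc ∣q∣≡k
subset-of-size {k = suc k} (outside ∷ p) k≤ with subset-of-size p k≤
... | q , q⊆p , ∣q∣≡k = outside ∷ q , s⊆s q⊆p , ∣q∣≡k

no-two-distinct⇒∣p∣≤1 : (∀ {x y} → x ∈ p → y ∈ p → x ≢ y → ⊥) → ∣ p ∣ ≤ 1
no-two-distinct⇒∣p∣≤1 {p = p} no-two with ∣ p ∣ ≤? 1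
... | yes ∣p∣≤1 = ∣p∣≤1
... | no ∣p∣≰1 = let x , y , x∈p , y∈p , x≢y = pick-two (≰⇒> ∣p∣≰1) in ⊥-elim (no-two x∈p y∈p x≢y)

no-three-distinct⇒∣p∣≤2 : (∀ {x y z} → x ∈ p → y ∈ p → z ∈ p → x ≢ y → x ≢ z → y ≢ z → ⊥) → ∣ p ∣ ≤ 2
no-three-distinct⇒∣p∣≤2 {p = p} no-three with ∣ p ∣ ≤? 2
... | yes ∣p∣≤2 = ∣p∣≤2
... | no ∣p∣≰2 with pick {p = p} (≰⇒> ∣p∣≰2)
... | x , x∈p , 2≤∣p-x∣ with pick-two {p = p - x} 2≤∣p-x∣
... | y , z , y∈p-x , z∈p-x , y≢z =
  let y∈p , y≢x = x∈p-y⁻ y∈p-x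
      z∈p , z≢x = x∈p-y⁻ z∈p-x
  in ⊥-elim (no-three x∈p y∈p z∈p (y≢x ∘ sym) (z≢x ∘ sym) y≢z)

fromList : List (Fin n) → Subset n
fromList = foldr (λ x p → ⁅ x ⁆ ∪ p) ∅

∣fromList∣≤length : ∀ (xs : List (Fin n)) → ∣ fromList xs ∣ ≤ length xs
∣fromList∣≤length {n} []       = ≤-reflexive (∣⊥∣≡0 n)
∣fromList∣≤length      (x ∷ xs) = begin
  ∣ ⁅ x ⁆ ∪ fromList xs ∣           ≤⟨ ∣p∪q∣≤∣p∣+∣q∣ ⁅ x ⁆ (fromList xs) ⟩
  ∣ ⁅ x ⁆ ∣ + ∣ fromList xs ∣       ≡⟨ cong (_+ ∣ fromList xs ∣) (∣⁅x⁆∣≡1 x) ⟩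
  suc ∣ fromList xs ∣               ≤⟨ s≤s (∣fromList∣≤length xs) ⟩
  suc (length xs)                   ∎
  where open ≤-Reasoning

∈ₗ⇒∈fromList : ∀ {xs : List (Fin n)} → x ∈ₗ xs → x ∈ fromList xs
∈ₗ⇒∈fromList (here refl)  = x∈p∪q⁺ (inj₁ (x∈⁅x⁆ _))
∈ₗ⇒∈fromList (there x∈xs) = x∈p∪q⁺ (inj₂ (∈ₗ⇒∈fromList x∈xs))

∈tabulate⁺ : ∀ (f : Fin n → Bool) → f x ≡ true → x ∈ tabulate f
∈tabulate⁺ {x = x} f fx = lookup⇒[]= x (tabulate f) (trans (lookup∘tabulate f x) fx)

∈tabulate⁻ : ∀ (f : Fin n → Bool) → x ∈ tabulate f → f x ≡ true
∈tabulate⁻ {x = x} f x∈ = trans (sym (lookup∘tabulate f x)) ([]=⇒lookup x∈)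

setOf : {P : Pred (Fin n) 0ℓ} → Decidable P → Subset n
setOf P? = tabulate (λ x → ⌊ P? x ⌋)

∈setOf⁺ : {P : Pred (Fin n) 0ℓ} (P? : Decidable P) → P x → x ∈ setOf P?
∈setOf⁺ {x = x} P? px = ∈tabulate⁺ _ (trans (isYes≗does (P? x)) (dec-true (P? x) px))

∈setOf⁻ : {P : Pred (Fin n) 0ℓ} (P? : Decidable P) → x ∈ setOf P? → P x
∈setOf⁻ {x = x} P? x∈ with P? x | ∈tabulate⁻ (λ y → ⌊ P? y ⌋) x∈
... | yes px | _ = px

module _ {n} (G : Graph n) where

  private
    variable
      u v w : Fin n
      D W : Subset n

  M*-refl : ∀ v → M* G v v ≡ true
  M*-refl v with v ≟ v
  ... | yes _   = refl
  ... | no v≢v = contradiction refl v≢v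

  M*-sym : ∀ v w → M* G v w ≡ M* G w v
  M*-sym v w with v ≟ w | w ≟ v
  ... | yes _    | yes _    = refl
  ... | yes v≡w  | no  w≢v = contradiction (sym v≡w) w≢v
  ... | no  v≢w  | yes w≡v = contradiction (sym w≡v) v≢w
  ... | no  _    | no  _    = adj-sym G v w

  adj⇒M* : adj G v w ≡ true → M* G v w ≡ true
  adj⇒M* {v} {w} vw rewrite vw = ∨-zeroʳ ⌊ v ≟ w ⌋

  M*-false⇒≢ : M* G v w ≡ false → v ≢ w
  M*-false⇒≢ {v} vw refl with () ← trans (sym (M*-refl v)) vw

  adj⇒≢ : adj G v w ≡ true → v ≢ w
  adj⇒≢ {v} vw refl with () ← trans (sym vw) (adj-irrefl G v)

  M*-≢ : M* G v w ≡ true → M* G v u ≡ false → w ≢ u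
  M*-≢ vw vu refl with () ← trans (sym vw) vu

  ∈closedNbhd⁺ : M* G v w ≡ true → w ∈ closedNbhd G v
  ∈closedNbhd⁺ = ∈tabulate⁺ _

  ∈closedNbhd⁻ : w ∈ closedNbhd G v → M* G v w ≡ true
  ∈closedNbhd⁻ = ∈tabulate⁻ _

  ∉closedNbhd⇒M*-false : w ∉ closedNbhd G v → M* G v w ≡ false
  ∉closedNbhd⇒M*-false w∉ = ¬-not (w∉ ∘ ∈closedNbhd⁺)

  M*-false⇒∈─closedNbhd : w ∈ D → M* G v w ≡ false → w ∈ D ─ closedNbhd G v
  M*-false⇒∈─closedNbhd w∈D vw = x∈p∧x∉q⇒x∈p─q w∈D λ w∈N → M*-≢ (∈closedNbhd⁻ w∈N) vw refl

  neighbour-≢ : MinDegree≥ G 2 → ∀ v w → ∃ λ u → adj G v u ≡ true × u ≢ w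
  neighbour-≢ δ≥2 v w with pick-≢ (δ≥2 v) w
  ... | u , u∈N , u≢w = u , ∈tabulate⁻ _ u∈N , u≢w

  two-neighbours : MinDegree≥ G 2 → ∀ v → ∃ λ w₁ → ∃ λ w₂ → adj G v w₁ ≡ true × adj G v w₂ ≡ true × w₁ ≢ w₂
  two-neighbours δ≥2 v =
    let w₁ , w₂ , w₁∈N , w₂∈N , w₁≢w₂ = pick-two (δ≥2 v) in w₁ , w₂ , ∈tabulate⁻ _ w₁∈N , ∈tabulate⁻ _ w₂∈N , w₁≢w₂

  Universal? : Decidable (Universal G)
  Universal? v = all? (λ w → M* G v w B.≟ true)

  universal-M* : Universal G u → M* G v u ≡ true
  universal-M* {u} {v} U = trans (M*-sym v u) (U v)

  M*-false⇒¬Universalˡ : M* G v w ≡ false → ¬ Universal G v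
  M*-false⇒¬Universalˡ {w = w} vw U with () ← trans (sym (U w)) vw

  M*-false⇒¬Universalʳ : M* G v w ≡ false → ¬ Universal G w
  M*-false⇒¬Universalʳ vw U with () ← trans (sym (universal-M* U)) vw

  ¬Universal⇒nonNeighbour : ¬ Universal G v → ∃ λ w → M* G v w ≡ false
  ¬Universal⇒nonNeighbour {v} ¬U with ¬∀⟶∃¬ n (λ w → M* G v w ≡ true) (λ w → M* G v w B.≟ true) ¬U
  ... | w , ¬vw = w , ¬-not ¬vw

  universal-≢ : Universal G v → ¬ Universal G w → v ≢ w
  universal-≢ Uv ¬Uw refl = ¬Uw Uv

  ∈universalSet⁺ : Universal G u → u ∈ universalSet G
  ∈universalSet⁺ = ∈setOf⁺ Universal?

  ∈universalSet⁻ : u ∈ universalSet G → Universal G u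
  ∈universalSet⁻ = ∈setOf⁻ Universal?

  ∣U∣≡0⇒¬Universal : ∣ universalSet G ∣ ≡ 0 → ∀ v → ¬ Universal G v
  ∣U∣≡0⇒¬Universal ∣U∣≡0 v Uv = contradiction (≤-trans (∈⇒suc≤ (∈universalSet⁺ Uv) z≤n) (≤-reflexive ∣U∣≡0)) λ ()

  ∣U∣≤2⇒nonuniversal : MinDegree≥ G 2 → ∣ universalSet G ∣ ≤ 2 → Fin n → ∃ λ w → ¬ Universal G w
  ∣U∣≤2⇒nonuniversal δ≥2 ∣U∣≤2 v with two-neighbours δ≥2 v
  ... | w₁ , w₂ , vw₁ , vw₂ , w₁≢w₂ with Universal? v | Universal? w₁ | Universal? w₂
  ... | no ¬Uv | _      | _      = v , ¬Uv
  ... | yes _  | no ¬U₁ | _      = w₁ , ¬U₁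
  ... | yes _  | yes _  | no ¬U₂ = w₂ , ¬U₂
  ... | yes Uv | yes U₁ | yes U₂ = contradiction (three-distinct⇒3≤ (∈universalSet⁺ Uv) (∈universalSet⁺ U₁)
    (∈universalSet⁺ U₂) (adj⇒≢ vw₁) (adj⇒≢ vw₂) w₁≢w₂) (<⇒≱ (s≤s ∣U∣≤2))

  nonuniversal-neighbour : MinDegree≥ G 2 → ∣ universalSet G ∣ ≤ 1 →
    ∀ v → ∃ λ w → adj G v w ≡ true × ¬ Universal G w
  nonuniversal-neighbour δ≥2 ∣U∣≤1 v with two-neighbours δ≥2 v
  ... | w₁ , w₂ , vw₁ , vw₂ , w₁≢w₂ with Universal? w₁ | Universal? w₂
  ... | no ¬U₁ | _      = w₁ , vw₁ , ¬U₁
  ... | yes _  | no ¬U₂ = w₂ , vw₂ , ¬U₂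
  ... | yes U₁ | yes U₂ = contradiction
    (two-distinct⇒2≤ (∈universalSet⁺ U₁) (∈universalSet⁺ U₂) w₁≢w₂) (<⇒≱ (s≤s ∣U∣≤1))

  MissesAtMost : ℕ → Subset n → Set
  MissesAtMost m D = ∀ v → ∣ D ─ closedNbhd G v ∣ ≤ m

  dominating⇒missesAtMost : IsKTupleDominating G k D → ∣ D ∣ ≤ k + m → MissesAtMost m D
  dominating⇒missesAtMost {k} {D} {m} dom ∣D∣≤k+m v = +-cancelˡ-≤ k _ _ (begin
    k + ∣ D ─ closedNbhd G v ∣                         ≤⟨ +-monoˡ-≤ _ (dom v) ⟩
    ∣ closedNbhd G v ∩ D ∣ + ∣ D ─ closedNbhd G v ∣    ≡⟨ ∣q∣≡∣p∩q∣+∣q─p∣ (closedNbhd G v) D ⟨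
    ∣ D ∣                                              ≤⟨ ∣D∣≤k+m ⟩
    k + m                                              ∎)
    where open ≤-Reasoning

  missesAtMost⇒dominating : MissesAtMost m D → k + m ≤ ∣ D ∣ → IsKTupleDominating G k D
  missesAtMost⇒dominating {m} {D} {k} misses k+m≤∣D∣ v = +-cancelʳ-≤ m _ _ (begin
    k + m                                              ≤⟨ k+m≤∣D∣ ⟩
    ∣ D ∣                                              ≡⟨ ∣q∣≡∣p∩q∣+∣q─p∣ (closedNbhd G v) D ⟩
    ∣ closedNbhd G v ∩ D ∣ + ∣ D ─ closedNbhd G v ∣    ≤⟨ +-monoʳ-≤ _ (misses v) ⟩
    ∣ closedNbhd G v ∩ D ∣ + m                         ∎)
    where open ≤-Reasoning

  missesAtMost-⊆ : D ⊆ W → MissesAtMost m W → MissesAtMost m D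
  missesAtMost-⊆ {D} {W} D⊆W misses v = ≤-trans (p⊆q⇒∣p∣≤∣q∣ D─N⊆W─N) (misses v)
    where
    D─N⊆W─N : D ─ closedNbhd G v ⊆ W ─ closedNbhd G v
    D─N⊆W─N x∈ = x∈p∧x∉q⇒x∈p─q (D⊆W (p─q⊆p D _ x∈)) (x∈p─q⇒x∉q x∈)

  dominating-subset : MissesAtMost m W → k + m ≤ ∣ W ∣ →
    ∃ λ D → IsKTupleDominating G k D × ∣ D ∣ ≤ k + m
  dominating-subset {W = W} misses k+m≤∣W∣ with subset-of-size W k+m≤∣W∣
  ... | D , D⊆W , ∣D∣≡k+m =
    D , missesAtMost⇒dominating (missesAtMost-⊆ D⊆W misses) (≤-reflexive (sym ∣D∣≡k+m)) , ≤-reflexive ∣D∣≡k+m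

  dominating⇒k≤∣D∣ : Fin n → IsKTupleDominating G k D → k ≤ ∣ D ∣
  dominating⇒k≤∣D∣ {D = D} v dom = ≤-trans (dom v) (∣p∩q∣≤∣q∣ (closedNbhd G v) D)

  missesAtMost0⇒⊆universalSet : MissesAtMost 0 D → D ⊆ universalSet G
  missesAtMost0⇒⊆universalSet {D} misses {u} u∈D =
    ∈universalSet⁺ λ w → trans (M*-sym u w) (seen-by w)
    where
    seen-by : ∀ v → M* G v u ≡ true
    seen-by v with M* G v u B.≟ true
    ... | yes vu = vu
    ... | no ¬vu with () ← ≤-trans (∈⇒suc≤ (M*-false⇒∈─closedNbhd u∈D (¬-not ¬vu)) z≤n) (misses v)

  universalSet-missesAtMost0 : MissesAtMost 0 (universalSet G)
  universalSet-missesAtMost0 v = ≤-reflexive (Empty⇒∣p∣≡0 {p = universalSet G ─ closedNbhd G v} λ (u , u∈) →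
    x∈p─q⇒x∉q u∈ (∈closedNbhd⁺ (universal-M* (∈universalSet⁻ (p─q⊆p _ _ u∈)))))

  ∣U∣<k⇒k<∣D∣ : Fin n → ∣ universalSet G ∣ < k → IsKTupleDominating G k D → k < ∣ D ∣
  ∣U∣<k⇒k<∣D∣ {k} {D} v ∣U∣<k dom with k <? ∣ D ∣
  ... | yes k<∣D∣ = k<∣D∣
  ... | no k≮∣D∣ = contradiction (≤-trans (dominating⇒k≤∣D∣ v dom) ∣D∣≤∣U∣) (<⇒≱ ∣U∣<k)
    where
    ∣D∣≤∣U∣ : ∣ D ∣ ≤ ∣ universalSet G ∣
    ∣D∣≤∣U∣ = p⊆q⇒∣p∣≤∣q∣ (missesAtMost0⇒⊆universalSet {D}
      (dominating⇒missesAtMost {m = 0} dom (≤-trans (≮⇒≥ k≮∣D∣) (≤-reflexive (sym (+-identityʳ k))))))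

  sees-three : ∀ (xs : List (Fin n)) {x y z} → x ∈ₗ xs → y ∈ₗ xs → z ∈ₗ xs → x ≢ y → x ≢ z → y ≢ z →
    M* G v x ≡ true → M* G v y ≡ true → M* G v z ≡ true → 3 ≤ ∣ closedNbhd G v ∩ fromList xs ∣
  sees-three _ x∈ y∈ z∈ x≢y x≢z y≢z vx vy vz = three-distinct⇒3≤
    (x∈p∩q⁺ (∈closedNbhd⁺ vx , ∈ₗ⇒∈fromList x∈)) (x∈p∩q⁺ (∈closedNbhd⁺ vy , ∈ₗ⇒∈fromList y∈))
    (x∈p∩q⁺ (∈closedNbhd⁺ vz , ∈ₗ⇒∈fromList z∈)) x≢y x≢z y≢z

  isKTupleDomNumber : ∀ {γ} → (∀ D → IsKTupleDominating G k D → γ ≤ ∣ D ∣) →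
    (∃ λ D → IsKTupleDominating G k D × ∣ D ∣ ≤ γ) → IsKTupleDomNumber G k γ
  isKTupleDomNumber lower (D , dom , ∣D∣≤γ) =
    (D , dom , ≤-antisym ∣D∣≤γ (lower D dom)) , lower

  DominatingPair : Fin n → Fin n → Set
  DominatingPair x y = ∀ v → M* G v x ≡ false → M* G v y ≡ false → ⊥

  DominatingPair-sym : DominatingPair v w → DominatingPair w v
  DominatingPair-sym vw u uw uv = vw u uv uw

  universal-dominatingPair : Universal G v → DominatingPair v w
  universal-dominatingPair Uv u uv _ = M*-≢ (universal-M* Uv) uv refl

  dominatingPair⇒sees-one : DominatingPair v w → ∀ u → M* G u v ≡ true ⊎ M* G u w ≡ true
  dominatingPair⇒sees-one {v} {w} vw u with M* G u v B.≟ true | M* G u w B.≟ true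
  ... | yes uv | _      = inj₁ uv
  ... | no _   | yes uw = inj₂ uw
  ... | no ¬uv | no ¬uw = ⊥-elim (vw u (¬-not ¬uv) (¬-not ¬uw))

  CommonNonNeighbour : Fin n → Fin n → Set
  CommonNonNeighbour v w = ∃ λ u → M* G u v ≡ false × M* G u w ≡ false

  PairwiseDominating : Subset n → Set
  PairwiseDominating W = ∀ {x y} → x ∈ W → y ∈ W → x ≢ y → DominatingPair x y

  pairwiseDominating⇒missesAtMost1 : PairwiseDominating W → MissesAtMost 1 W
  pairwiseDominating⇒missesAtMost1 {W} pairs v = no-two-distinct⇒∣p∣≤1 λ x∈ y∈ x≢y →
    pairs (p─q⊆p W _ x∈) (p─q⊆p W _ y∈) x≢y v (missed x∈) (missed y∈)
    where
    missed : ∀ {x} → x ∈ W ─ closedNbhd G v → M* G v x ≡ false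
    missed = ∉closedNbhd⇒M*-false ∘ x∈p─q⇒x∉q

  record CliqueCover (P Q : Pred (Fin n) 0ℓ) : Set where
    field
      cover          : ∀ v → ¬ Universal G v → P v ⊎ Q v
      P-clique       : ∀ {v w} → P v → P w → M* G v w ≡ true
      Q-clique       : ∀ {v w} → Q v → Q w → M* G v w ≡ true
      P-nonuniversal : ∀ {v} → P v → ¬ Universal G v
      Q-nonuniversal : ∀ {v} → Q v → ¬ Universal G v

  swap : ∀ {P Q} → CliqueCover P Q → CliqueCover Q P
  swap cc = record
    { cover = λ v ¬U → Sum.swap (cover v ¬U)
    ; P-clique = Q-clique ; Q-clique = P-clique
    ; P-nonuniversal = Q-nonuniversal ; Q-nonuniversal = P-nonuniversal
    }
    where open CliqueCover cc

  module _ {P Q} (cc : CliqueCover P Q) where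
    open CliqueCover cc

    other-class-nonNeighbour : P v → ∃ λ w → Q w × M* G v w ≡ false
    other-class-nonNeighbour Pv with ¬Universal⇒nonNeighbour (P-nonuniversal Pv)
    ... | w , vw with cover w (M*-false⇒¬Universalʳ vw)
    ... | inj₁ Pw with () ← trans (sym (P-clique Pv Pw)) vw
    ... | inj₂ Qw = w , Qw , vw

    P-Q-disjoint : P v → Q v → ⊥
    P-Q-disjoint Pv Qv with other-class-nonNeighbour Pv
    ... | w , Qw , vw with () ← trans (sym (Q-clique Qv Qw)) vw

    P-Q-dominatingPair : ∀ {x y} → P x → Q y → DominatingPair x y
    P-Q-dominatingPair Px Qy v vx vy with cover v (M*-false⇒¬Universalˡ vx)
    ... | inj₁ Pv with () ← trans (sym (P-clique Pv Px)) vx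
    ... | inj₂ Qv with () ← trans (sym (Q-clique Qv Qy)) vy

    module _ {S₁ S₂ : Subset n} (S₁⊆P : ∀ {x} → x ∈ S₁ → P x) (S₂⊆Q : ∀ {x} → x ∈ S₂ → Q x) where

      ∣U∪S₁∪S₂∣≡∣U∣+∣S₁∣+∣S₂∣ : ∣ universalSet G ∪ (S₁ ∪ S₂) ∣ ≡ ∣ universalSet G ∣ + (∣ S₁ ∣ + ∣ S₂ ∣)
      ∣U∪S₁∪S₂∣≡∣U∣+∣S₁∣+∣S₂∣ = begin
        ∣ universalSet G ∪ (S₁ ∪ S₂) ∣       ≡⟨ disjoint⇒∣p∪q∣≡∣p∣+∣q∣ _ _ U∩S-empty ⟩
        ∣ universalSet G ∣ + ∣ S₁ ∪ S₂ ∣     ≡⟨ cong (∣ universalSet G ∣ +_) (disjoint⇒∣p∪q∣≡∣p∣+∣q∣ _ _ S₁∩S₂-empty) ⟩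
        ∣ universalSet G ∣ + (∣ S₁ ∣ + ∣ S₂ ∣) ∎
        where
        open ≡-Reasoning
        U∩S-empty : ∀ {x} → x ∈ universalSet G → x ∉ S₁ ∪ S₂
        U∩S-empty x∈U x∈S with x∈p∪q⁻ S₁ S₂ x∈S
        ... | inj₁ x∈S₁ = P-nonuniversal (S₁⊆P x∈S₁) (∈universalSet⁻ x∈U)
        ... | inj₂ x∈S₂ = Q-nonuniversal (S₂⊆Q x∈S₂) (∈universalSet⁻ x∈U)
        S₁∩S₂-empty : ∀ {x} → x ∈ S₁ → x ∉ S₂
        S₁∩S₂-empty x∈S₁ x∈S₂ = P-Q-disjoint (S₁⊆P x∈S₁) (S₂⊆Q x∈S₂)

      private
        classify : ∀ {x} → x ∈ universalSet G ∪ (S₁ ∪ S₂) → Universal G x ⊎ (x ∈ S₁ ⊎ x ∈ S₂)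
        classify x∈ = Sum.map ∈universalSet⁻ (x∈p∪q⁻ S₁ S₂) (x∈p∪q⁻ _ _ x∈)

      U∪S₁∪S₂-pairwiseDominating : PairwiseDominating S₁ → PairwiseDominating S₂ →
        PairwiseDominating (universalSet G ∪ (S₁ ∪ S₂))
      U∪S₁∪S₂-pairwiseDominating pd₁ pd₂ x∈ y∈ x≢y with classify x∈ | classify y∈
      ... | inj₁ Ux         | _                 = universal-dominatingPair Ux
      ... | _               | inj₁ Uy           = DominatingPair-sym (universal-dominatingPair Uy)
      ... | inj₂ (inj₁ x∈S₁) | inj₂ (inj₁ y∈S₁) = pd₁ x∈S₁ y∈S₁ x≢y
      ... | inj₂ (inj₁ x∈S₁) | inj₂ (inj₂ y∈S₂) = P-Q-dominatingPair (S₁⊆P x∈S₁) (S₂⊆Q y∈S₂)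
      ... | inj₂ (inj₂ x∈S₂) | inj₂ (inj₁ y∈S₁) = DominatingPair-sym (P-Q-dominatingPair (S₁⊆P y∈S₁) (S₂⊆Q x∈S₂))
      ... | inj₂ (inj₂ x∈S₂) | inj₂ (inj₂ y∈S₂) = pd₂ x∈S₂ y∈S₂ x≢y

    ∣D∣≤∣U∣+∣P∩D∣+∣Q∩D∣ : (P? : Decidable P) (Q? : Decidable Q) →
      ∀ D → ∣ D ∣ ≤ ∣ universalSet G ∣ + (∣ setOf P? ∩ D ∣ + ∣ setOf Q? ∩ D ∣)
    ∣D∣≤∣U∣+∣P∩D∣+∣Q∩D∣ P? Q? D = begin
      ∣ D ∣                                                       ≤⟨ p⊆q⇒∣p∣≤∣q∣ D⊆ ⟩
      ∣ universalSet G ∪ (setOf P? ∩ D ∪ setOf Q? ∩ D) ∣          ≤⟨ ∣p∪q∣≤∣p∣+∣q∣ (universalSet G) _ ⟩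
      ∣ universalSet G ∣ + ∣ setOf P? ∩ D ∪ setOf Q? ∩ D ∣        ≤⟨ +-monoʳ-≤ _ (∣p∪q∣≤∣p∣+∣q∣ (setOf P? ∩ D) (setOf Q? ∩ D)) ⟩
      ∣ universalSet G ∣ + (∣ setOf P? ∩ D ∣ + ∣ setOf Q? ∩ D ∣)  ∎
      where
      open ≤-Reasoning
      D⊆ : D ⊆ universalSet G ∪ (setOf P? ∩ D ∪ setOf Q? ∩ D)
      D⊆ {x} x∈D with Universal? x
      ... | yes Ux = x∈p∪q⁺ (inj₁ (∈universalSet⁺ Ux))
      ... | no ¬Ux with cover x ¬Ux
      ... | inj₁ Px = x∈p∪q⁺ (inj₂ (x∈p∪q⁺ (inj₁ (x∈p∩q⁺ (∈setOf⁺ P? Px , x∈D)))))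
      ... | inj₂ Qx = x∈p∪q⁺ (inj₂ (x∈p∪q⁺ (inj₂ (x∈p∩q⁺ (∈setOf⁺ Q? Qx , x∈D)))))

  module _ {P Q} (cc : CliqueCover P Q) where
    open CliqueCover cc

    second-member : MinDegree≥ G 2 → ∣ universalSet G ∣ ≤ 1 →
      ∀ {a} → P a → ∃ λ a' → P a' × a' ≢ a
    second-member δ≥2 ∣U∣≤1 {a} Pa with nonuniversal-neighbour δ≥2 ∣U∣≤1 a
    ... | b , ab , ¬Ub with cover b ¬Ub
    ... | inj₁ Pb = b , Pb , adj⇒≢ ab ∘ sym
    ... | inj₂ Qb with other-class-nonNeighbour (swap cc) Qb
    ... | z , Pz , bz = z , Pz , M*-≢ (trans (M*-sym b a) (adj⇒M* ab)) bz ∘ sym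

    third-member-or-private-neighbour : MinDegree≥ G 2 → (∀ v → ¬ Universal G v) →
      ∀ {a a'} → P a → a ≢ a' →
      (∃ λ c → P c × c ≢ a × c ≢ a') ⊎ (∃ λ b → Q b × M* G a b ≡ true × M* G b a' ≡ false)
    third-member-or-private-neighbour δ≥2 noU {a} {a'} Pa a≢a' with neighbour-≢ δ≥2 a a'
    ... | b , ab , b≢a' with cover b (noU b)
    ... | inj₁ Pb = inj₁ (b , Pb , adj⇒≢ ab ∘ sym , b≢a')
    ... | inj₂ Qb with other-class-nonNeighbour (swap cc) Qb
    ... | z , Pz , bz with z ≟ a'
    ... | yes refl = inj₂ (b , Qb , adj⇒M* ab , bz)
    ... | no z≢a' = inj₁ (z , Pz , M*-≢ (trans (M*-sym b a) (adj⇒M* ab)) bz ∘ sym , z≢a')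

    -- Unless a neighbour already yields a third member, a has a Q-neighbour b₀ ≁ a' and a' a
    -- Q-neighbour b₁ ≁ a; a common non-neighbour of b₀ and b₁ lies in P but is neither a nor a'.
    third-member : MinDegree≥ G 2 → (∀ v → ¬ Universal G v) →
      (∀ {b b'} → Q b → Q b' → b ≢ b' → CommonNonNeighbour b b') →
      ∀ {a a'} → P a → P a' → a ≢ a' → ∃ λ c → P c × c ≢ a × c ≢ a'
    third-member δ≥2 noU meet {a} {a'} Pa Pa' a≢a'
      with third-member-or-private-neighbour δ≥2 noU Pa a≢a'
         | third-member-or-private-neighbour δ≥2 noU Pa' (a≢a' ∘ sym)
    ... | inj₁ (c , Pc , c≢a , c≢a') | _ = c , Pc , c≢a , c≢a'
    ... | inj₂ _ | inj₁ (c , Pc , c≢a' , c≢a) = c , Pc , c≢a , c≢a'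
    ... | inj₂ (b₀ , Qb₀ , ab₀ , b₀a') | inj₂ (b₁ , Qb₁ , a'b₁ , b₁a)
      with meet Qb₀ Qb₁ (M*-≢ ab₀ (trans (M*-sym a b₁) b₁a))
    ... | w , wb₀ , wb₁ with cover w (M*-false⇒¬Universalˡ wb₀)
    ... | inj₂ Qw with () ← trans (sym (Q-clique Qw Qb₀)) wb₀
    ... | inj₁ Pw =
      w , Pw , M*-≢ (trans (M*-sym b₀ a) ab₀) (trans (M*-sym b₀ w) wb₀) ∘ sym
             , M*-≢ (trans (M*-sym b₁ a') a'b₁) (trans (M*-sym b₁ w) wb₁) ∘ sym

    classes-inhabited : ¬ Universal G v → ∃ P × ∃ Q
    classes-inhabited {v} ¬Uv with cover v ¬Uv
    ... | inj₁ Pv = let w , Qw , _ = other-class-nonNeighbour cc Pv in (v , Pv) , (w , Qw)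
    ... | inj₂ Qv = let w , Pw , _ = other-class-nonNeighbour (swap cc) Qv in (w , Pw) , (v , Qv)

    P-Q-≢ : ∀ {x y} → P x → Q y → x ≢ y
    P-Q-≢ Px Qy refl = P-Q-disjoint cc Px Qy

    dominating-u+2+2 : ∀ {u a a' b b'} → Universal G u → P a → P a' → Q b → Q b' → a ≢ a' → b ≢ b' →
      ∃ λ D → IsKTupleDominating G 3 D × ∣ D ∣ ≤ 5
    dominating-u+2+2 {u} {a} {a'} {b} {b'} Uu Pa Pa' Qb Qb' a≢a' b≢b' =
      fromList xs , dominating , ∣fromList∣≤length xs
      where
      xs = u ∷ a ∷ a' ∷ b ∷ b' ∷ []
      u≢a = universal-≢ Uu (P-nonuniversal Pa)
      u≢a' = universal-≢ Uu (P-nonuniversal Pa')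
      u≢b = universal-≢ Uu (Q-nonuniversal Qb)
      u≢b' = universal-≢ Uu (Q-nonuniversal Qb')
      dominating : IsKTupleDominating G 3 (fromList xs)
      dominating v with Universal? v
      ... | yes Uv = sees-three xs ∈₀ ∈₁ ∈₂ u≢a u≢a' a≢a' (Uv u) (Uv a) (Uv a')
      ... | no ¬Uv with cover v ¬Uv
      ... | inj₁ Pv = sees-three xs ∈₀ ∈₁ ∈₂ u≢a u≢a' a≢a' (universal-M* Uu) (P-clique Pv Pa) (P-clique Pv Pa')
      ... | inj₂ Qv = sees-three xs ∈₀ ∈₃ ∈₄ u≢b u≢b' b≢b' (universal-M* Uu) (Q-clique Qv Qb) (Q-clique Qv Qb')

    module _ (noU : ∀ v → ¬ Universal G v) where

      dominating-3+3 : ∀ {a a' a'' b b' b''} → P a → P a' → P a'' → Q b → Q b' → Q b'' →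
        a ≢ a' → a ≢ a'' → a' ≢ a'' → b ≢ b' → b ≢ b'' → b' ≢ b'' →
        ∃ λ D → IsKTupleDominating G 3 D × ∣ D ∣ ≤ 6
      dominating-3+3 {a} {a'} {a''} {b} {b'} {b''} Pa Pa' Pa'' Qb Qb' Qb'' a≢a' a≢a'' a'≢a'' b≢b' b≢b'' b'≢b'' =
        fromList xs , dominating , ∣fromList∣≤length xs
        where
        xs = a ∷ a' ∷ a'' ∷ b ∷ b' ∷ b'' ∷ []
        dominating : IsKTupleDominating G 3 (fromList xs)
        dominating v with cover v (noU v)
        ... | inj₁ Pv = sees-three xs ∈₀ ∈₁ ∈₂ a≢a' a≢a'' a'≢a''
                          (P-clique Pv Pa) (P-clique Pv Pa') (P-clique Pv Pa'')
        ... | inj₂ Qv = sees-three xs ∈₃ ∈₄ ∈₅ b≢b' b≢b'' b'≢b''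
                          (Q-clique Qv Qb) (Q-clique Qv Qb') (Q-clique Qv Qb'')

      -- A vertex of Q sees b, b' and, since {a, a'} dominates G, one of a, a'.
      dominating-3+2 : ∀ {a a' c b b'} → P a → P a' → P c → Q b → Q b' →
        a ≢ a' → c ≢ a → c ≢ a' → b ≢ b' → DominatingPair a a' →
        ∃ λ D → IsKTupleDominating G 3 D × ∣ D ∣ ≤ 5
      dominating-3+2 {a} {a'} {c} {b} {b'} Pa Pa' Pc Qb Qb' a≢a' c≢a c≢a' b≢b' aa' =
        fromList xs , dominating , ∣fromList∣≤length xs
        where
        xs = a ∷ a' ∷ c ∷ b ∷ b' ∷ []
        dominating : IsKTupleDominating G 3 (fromList xs)
        dominating v with cover v (noU v)
        ... | inj₁ Pv = sees-three xs ∈₀ ∈₁ ∈₂ a≢a' (c≢a ∘ sym) (c≢a' ∘ sym)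
                          (P-clique Pv Pa) (P-clique Pv Pa') (P-clique Pv Pc)
        ... | inj₂ Qv with dominatingPair⇒sees-one aa' v
        ... | inj₁ va  = sees-three xs ∈₀ ∈₃ ∈₄ (P-Q-≢ Pa Qb) (P-Q-≢ Pa Qb') b≢b'
                           va (Q-clique Qv Qb) (Q-clique Qv Qb')
        ... | inj₂ va' = sees-three xs ∈₁ ∈₃ ∈₄ (P-Q-≢ Pa' Qb) (P-Q-≢ Pa' Qb') b≢b'
                           va' (Q-clique Qv Qb) (Q-clique Qv Qb')

  module _ {P Q} (cc : CliqueCover P Q) (δ≥2 : MinDegree≥ G 2) where

    dominating-u+2+2-from : ∣ universalSet G ∣ ≤ 1 → Universal G u → ∀ {a b} → P a → Q b →
      ∃ λ D → IsKTupleDominating G 3 D × ∣ D ∣ ≤ 5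
    dominating-u+2+2-from ∣U∣≤1 Uu Pa Qb =
      let a' , Pa' , a'≢a = second-member cc δ≥2 ∣U∣≤1 Pa
          b' , Qb' , b'≢b = second-member (swap cc) δ≥2 ∣U∣≤1 Qb
      in dominating-u+2+2 cc Uu Pa Pa' Qb Qb' (a'≢a ∘ sym) (b'≢b ∘ sym)

    module _ (∣U∣≡0 : ∣ universalSet G ∣ ≡ 0)
             (Q-meet : ∀ {b b'} → Q b → Q b' → b ≢ b' → CommonNonNeighbour b b') where

      private
        noU : ∀ v → ¬ Universal G v
        noU = ∣U∣≡0⇒¬Universal ∣U∣≡0
        ∣U∣≤1 : ∣ universalSet G ∣ ≤ 1
        ∣U∣≤1 = ≤-trans (≤-reflexive ∣U∣≡0) z≤n

      dominating-3+3-from : (∀ {a a'} → P a → P a' → a ≢ a' → CommonNonNeighbour a a') →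
        ∀ {a b} → P a → Q b → ∃ λ D → IsKTupleDominating G 3 D × ∣ D ∣ ≤ 6
      dominating-3+3-from P-meet Pa Qb =
        let a' , Pa' , a'≢a = second-member cc δ≥2 ∣U∣≤1 Pa
            b' , Qb' , b'≢b = second-member (swap cc) δ≥2 ∣U∣≤1 Qb
            a'' , Pa'' , a''≢a , a''≢a' = third-member cc δ≥2 noU Q-meet Pa Pa' (a'≢a ∘ sym)
            b'' , Qb'' , b''≢b , b''≢b' = third-member (swap cc) δ≥2 noU P-meet Qb Qb' (b'≢b ∘ sym)
        in dominating-3+3 cc noU Pa Pa' Pa'' Qb Qb' Qb''
             (a'≢a ∘ sym) (a''≢a ∘ sym) (a''≢a' ∘ sym) (b'≢b ∘ sym) (b''≢b ∘ sym) (b''≢b' ∘ sym)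

      dominating-3+2-from : ∀ {a a' b} → P a → P a' → a ≢ a' → DominatingPair a a' → Q b →
        ∃ λ D → IsKTupleDominating G 3 D × ∣ D ∣ ≤ 5
      dominating-3+2-from Pa Pa' a≢a' aa' Qb =
        let c , Pc , c≢a , c≢a' = third-member cc δ≥2 noU Q-meet Pa Pa' a≢a'
            b' , Qb' , b'≢b = second-member (swap cc) δ≥2 ∣U∣≤1 Qb
        in dominating-3+2 cc noU Pa Pa' Pc Qb Qb' a≢a' c≢a c≢a' (b'≢b ∘ sym) aa'

  module _ (σ : Permutation′ n) where

    private
      position-of : ∀ v → σ ⟨$⟩ʳ pos G σ v ≡ v
      position-of v = inverseʳ σ

    meets⇒commonNonNeighbour : IntervalsMeet G σ v w → CommonNonNeighbour v w
    meets⇒commonNonNeighbour (p , _ , pv , pw) = σ ⟨$⟩ʳ p , pv , pw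

    commonNonNeighbour⇒meets : M* G u v ≡ false → M* G u w ≡ false → IntervalsMeet G σ v w
    commonNonNeighbour⇒meets {u} uv uw rewrite sym (position-of u) =
      pos G σ u , M*-false⇒¬Universalˡ uv , uv , uw

    meets? : ∀ v w → Dec (IntervalsMeet G σ v w)
    meets? v w = any? λ p → ¬? (Universal? (σ ⟨$⟩ʳ p))
      ×-dec M* G (σ ⟨$⟩ʳ p) v B.≟ false ×-dec M* G (σ ⟨$⟩ʳ p) w B.≟ false

    C₁? : Decidable (C₁ G σ)
    C₁? v = ¬? (Universal? v) ×-dec
      all? (λ w → ¬? (Universal? w) →-dec M* G w v B.≟ false →-dec pos G σ v <ᶠ? pos G σ w)

    C₂? : Decidable (C₂ G σ)
    C₂? v = ¬? (Universal? v) ×-dec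
      all? (λ w → ¬? (Universal? w) →-dec M* G w v B.≟ false →-dec pos G σ w <ᶠ? pos G σ v)

    module _ {C : Pred (Fin n) 0ℓ} where

      independent⇒pairwiseDominating : ∀ {S} → IndependentIn G σ C S → PairwiseDominating S
      independent⇒pairwiseDominating (_ , apart) x∈ y∈ x≢y v vx vy =
        apart _ _ x∈ y∈ x≢y (commonNonNeighbour⇒meets vx vy)

      singleton-independent : C v → IndependentIn G σ C ⁅ v ⁆
      singleton-independent {v} Cv =
        (λ w w∈ → subst C (sym (x∈⁅y⁆⇒x≡y v w∈)) Cv) ,
        (λ x y x∈ y∈ x≢y → contradiction (trans (x∈⁅y⁆⇒x≡y v x∈) (sym (x∈⁅y⁆⇒x≡y v y∈))) x≢y)

      pair-independent : C v → C w → ¬ IntervalsMeet G σ v w → IndependentIn G σ C (⁅ v ⁆ ∪ ⁅ w ⁆)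
      pair-independent {v} {w} Cv Cw apart = in-C , pairwise-apart
        where
        cases : ∀ {x} → x ∈ ⁅ v ⁆ ∪ ⁅ w ⁆ → x ≡ v ⊎ x ≡ w
        cases {x} x∈ = Sum.map (x∈⁅y⁆⇒x≡y v) (x∈⁅y⁆⇒x≡y w) (x∈p∪q⁻ ⁅ v ⁆ ⁅ w ⁆ x∈)
        in-C : ∀ x → x ∈ ⁅ v ⁆ ∪ ⁅ w ⁆ → C x
        in-C x x∈ with cases x∈
        ... | inj₁ refl = Cv
        ... | inj₂ refl = Cw
        pairwise-apart : ∀ x y → x ∈ ⁅ v ⁆ ∪ ⁅ w ⁆ → y ∈ ⁅ v ⁆ ∪ ⁅ w ⁆ → x ≢ y → ¬ IntervalsMeet G σ x y
        pairwise-apart x y x∈ y∈ x≢y with cases x∈ | cases y∈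
        ... | inj₁ refl | inj₁ refl = contradiction refl x≢y
        ... | inj₁ refl | inj₂ refl = apart
        ... | inj₂ refl | inj₁ refl = λ { (p , ¬U , pw , pv) → apart (p , ¬U , pv , pw) }
        ... | inj₂ refl | inj₂ refl = contradiction refl x≢y

      module _ {α} (α-is-max : ∀ S → IndependentIn G σ C S → ∣ S ∣ ≤ α) where

        member⇒1≤α : C v → 1 ≤ α
        member⇒1≤α {v} Cv = ≤-trans (≤-reflexive (sym (∣⁅x⁆∣≡1 v))) (α-is-max _ (singleton-independent Cv))

        α≤1⇒commonNonNeighbour : α ≤ 1 → C v → C w → v ≢ w → CommonNonNeighbour v w
        α≤1⇒commonNonNeighbour {v} {w} α≤1 Cv Cw v≢w with meets? v w
        ... | yes meets = meets⇒commonNonNeighbour meets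
        ... | no apart = contradiction (≤-trans 2≤∣pair∣ (≤-trans (α-is-max _ (pair-independent Cv Cw apart)) α≤1))
                                       λ { (s≤s ()) }
          where
          2≤∣pair∣ : 2 ≤ ∣ ⁅ v ⁆ ∪ ⁅ w ⁆ ∣
          2≤∣pair∣ = two-distinct⇒2≤ (x∈p∪q⁺ (inj₁ (x∈⁅x⁆ v))) (x∈p∪q⁺ (inj₂ (x∈⁅x⁆ w))) v≢w

      missesAtMost1⇒independent : (C? : Decidable C) → ∀ {D} → MissesAtMost 1 D →
        IndependentIn G σ C (setOf C? ∩ D)
      missesAtMost1⇒independent C? {D} misses = in-C , apart
        where
        in-C : ∀ x → x ∈ setOf C? ∩ D → C x
        in-C x x∈ = ∈setOf⁻ C? (proj₁ (x∈p∩q⁻ _ _ x∈))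
        apart : ∀ x y → x ∈ setOf C? ∩ D → y ∈ setOf C? ∩ D → x ≢ y → ¬ IntervalsMeet G σ x y
        apart x y x∈ y∈ x≢y meets with meets⇒commonNonNeighbour meets
        ... | w , wx , wy = contradiction (≤-trans 2≤missed (misses w)) λ { (s≤s ()) }
          where
          2≤missed : 2 ≤ ∣ D ─ closedNbhd G w ∣
          2≤missed = two-distinct⇒2≤ (M*-false⇒∈─closedNbhd (proj₂ (x∈p∩q⁻ _ _ x∈)) wx)
                                     (M*-false⇒∈─closedNbhd (proj₂ (x∈p∩q⁻ _ _ y∈)) wy) x≢y

      2≤α⇒dominatingPair : ∀ {α} → IsIndependenceNumber G σ C α → 2 ≤ α →
        ∃ λ a → ∃ λ a' → C a × C a' × a ≢ a' × DominatingPair a a'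
      2≤α⇒dominatingPair ((S , S-independent , ∣S∣≡α) , _) 2≤α
        with pick-two {p = S} (≤-trans 2≤α (≤-reflexive (sym ∣S∣≡α)))
      ... | a , a' , a∈S , a'∈S , a≢a' =
        a , a' , proj₁ S-independent a a∈S , proj₁ S-independent a' a'∈S , a≢a' ,
        independent⇒pairwiseDominating S-independent a∈S a'∈S a≢a'

    module _ (ord : CoBiconvexOrderingMinusU G σ) where

      private
        pos-injective : pos G σ v ≡ pos G σ w → v ≡ w
        pos-injective {v} {w} e = trans (sym (position-of v)) (trans (cong (σ ⟨$⟩ʳ_) e) (position-of w))

        at-position : ∀ (P : Pred (Fin n) 0ℓ) {v} → P v → P (σ ⟨$⟩ʳ pos G σ v)
        at-position P {v} = subst P (sym (position-of v))

      convex : ∀ {a b c j} → ¬ Universal G b → pos G σ a ≤ᶠ pos G σ b → pos G σ b ≤ᶠ pos G σ c →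
        M* G a j ≡ false → M* G c j ≡ false → M* G b j ≡ false
      convex {a} {b} {c} {j} ¬Ub a≤b b≤c aj cj = subst ∉N[j] (position-of b)
        (ord j (M*-false⇒¬Universalʳ aj) (pos G σ a) (pos G σ b) (pos G σ c)
          (at-position ¬U (M*-false⇒¬Universalˡ aj)) (at-position ¬U ¬Ub) (at-position ¬U (M*-false⇒¬Universalˡ cj))
          a≤b b≤c (at-position ∉N[j] aj) (at-position ∉N[j] cj))
        where
        ¬U ∉N[j] : Pred (Fin n) 0ℓ
        ¬U x = ¬ Universal G x
        ∉N[j] x = M* G x j ≡ false

      C₁⊎C₂ : ∀ v → ¬ Universal G v → C₁ G σ v ⊎ C₂ G σ v
      C₁⊎C₂ v ¬Uv with any? (λ w → ¬? (Universal? w) ×-dec M* G w v B.≟ false ×-dec pos G σ w <ᶠ? pos G σ v)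
      ... | yes (w₀ , _ , w₀v , w₀<v) = inj₂ (¬Uv , above)
        where
        above : ∀ w → ¬ Universal G w → M* G w v ≡ false → pos G σ w <ᶠ pos G σ v
        above w _ wv with <ᶠ-cmp (pos G σ w) (pos G σ v)
        ... | tri< w<v _ _ = w<v
        ... | tri≈ _ w≡v _ = contradiction (pos-injective w≡v) (M*-false⇒≢ wv)
        ... | tri> _ _ v<w = contradiction refl (M*-false⇒≢ (convex ¬Uv (<⇒≤ w₀<v) (<⇒≤ v<w) w₀v wv))
      ... | no none-above = inj₁ (¬Uv , below)
        where
        below : ∀ w → ¬ Universal G w → M* G w v ≡ false → pos G σ w >ᶠ pos G σ v
        below w ¬Uw wv with <ᶠ-cmp (pos G σ w) (pos G σ v)
        ... | tri< w<v _ _ = contradiction (w , ¬Uw , wv , w<v) none-above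
        ... | tri≈ _ w≡v _ = contradiction (pos-injective w≡v) (M*-false⇒≢ wv)
        ... | tri> _ _ v<w = v<w

      C₁-clique : C₁ G σ v → C₁ G σ w → M* G v w ≡ true
      C₁-clique {v} {w} (¬Uv , below-v) (¬Uw , below-w) with M* G v w B.≟ true
      ... | yes vw = vw
      ... | no ¬vw = contradiction (below-w v ¬Uv (¬-not ¬vw)) (<ᶠ-asym (below-v w ¬Uw (trans (M*-sym w v) (¬-not ¬vw))))

      C₂-clique : C₂ G σ v → C₂ G σ w → M* G v w ≡ true
      C₂-clique {v} {w} (¬Uv , above-v) (¬Uw , above-w) with M* G v w B.≟ true
      ... | yes vw = vw
      ... | no ¬vw = contradiction (above-w v ¬Uv (¬-not ¬vw)) (<ᶠ-asym (above-v w ¬Uw (trans (M*-sym w v) (¬-not ¬vw))))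

      C₁C₂-cliqueCover : CliqueCover (C₁ G σ) (C₂ G σ)
      C₁C₂-cliqueCover = record
        { cover = C₁⊎C₂ ; P-clique = C₁-clique ; Q-clique = C₂-clique
        ; P-nonuniversal = proj₁ ; Q-nonuniversal = proj₁ }

      -- The non-neighbourhoods are intervals of positions, so this is Helly's property for three intervals.
      helly : ∀ {a b c} → CommonNonNeighbour a b → CommonNonNeighbour b c → CommonNonNeighbour a c →
        ∃ λ w → M* G w a ≡ false × M* G w b ≡ false × M* G w c ≡ false
      helly (x , xa , xb) (y , yb , yc) (z , za , zc)
        with ≤ᶠ-total (pos G σ x) (pos G σ y) | ≤ᶠ-total (pos G σ y) (pos G σ z) | ≤ᶠ-total (pos G σ x) (pos G σ z)
      ... | inj₁ x≤y | inj₁ y≤z | _        = y , convex (M*-false⇒¬Universalˡ yb) x≤y y≤z xa za , yb , yc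
      ... | inj₁ x≤y | inj₂ z≤y | inj₁ x≤z = z , za , convex (M*-false⇒¬Universalˡ za) x≤z z≤y xb yb , zc
      ... | inj₁ x≤y | inj₂ z≤y | inj₂ z≤x = x , xa , xb , convex (M*-false⇒¬Universalˡ xa) z≤x x≤y zc yc
      ... | inj₂ y≤x | inj₁ y≤z | inj₁ x≤z = x , xa , xb , convex (M*-false⇒¬Universalˡ xa) y≤x x≤z yc zc
      ... | inj₂ y≤x | inj₁ y≤z | inj₂ z≤x = z , za , convex (M*-false⇒¬Universalˡ za) y≤z z≤x yb xb , zc
      ... | inj₂ y≤x | inj₂ z≤y | _        = y , convex (M*-false⇒¬Universalˡ yb) z≤y y≤x za xa , yb , yc

      missesAtMost2⇒∣C∩D∣≤2 : ∀ {C : Pred (Fin n) 0ℓ} (C? : Decidable C) →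
        (∀ {x y} → C x → C y → x ≢ y → CommonNonNeighbour x y) →
        ∀ {D} → MissesAtMost 2 D → ∣ setOf C? ∩ D ∣ ≤ 2
      missesAtMost2⇒∣C∩D∣≤2 {C} C? meet {D} misses = no-three-distinct⇒∣p∣≤2 no-three
        where
        in-C : ∀ {v} → v ∈ setOf C? ∩ D → C v
        in-C v∈ = ∈setOf⁻ C? (proj₁ (x∈p∩q⁻ _ _ v∈))
        no-three : ∀ {x y z} → x ∈ setOf C? ∩ D → y ∈ setOf C? ∩ D → z ∈ setOf C? ∩ D →
          x ≢ y → x ≢ z → y ≢ z → ⊥
        no-three {x} {y} {z} x∈ y∈ z∈ x≢y x≢z y≢z
          with helly (meet (in-C x∈) (in-C y∈) x≢y) (meet (in-C y∈) (in-C z∈) y≢z) (meet (in-C x∈) (in-C z∈) x≢z)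
        ... | w , wx , wy , wz = contradiction (≤-trans 3≤missed (misses w)) λ { (s≤s (s≤s ())) }
          where
          missed : ∀ {v} → v ∈ setOf C? ∩ D → M* G w v ≡ false → v ∈ D ─ closedNbhd G w
          missed v∈ = M*-false⇒∈─closedNbhd (proj₂ (x∈p∩q⁻ _ _ v∈))
          3≤missed : 3 ≤ ∣ D ─ closedNbhd G w ∣
          3≤missed = three-distinct⇒3≤ (missed x∈ wx) (missed y∈ wy) (missed z∈ wz) x≢y x≢z y≢z

module Cases {n} (G : Graph n) (δ≥2 : MinDegree≥ G 2) (σ : Permutation′ n) (ord : CoBiconvexOrderingMinusU G σ)
             {α₁ α₂ : ℕ} (α₁-max : IsIndependenceNumber G σ (C₁ G σ) α₁)
             (α₂-max : IsIndependenceNumber G σ (C₂ G σ) α₂) where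

  private
    U : Subset n
    U = universalSet G

    cc : CliqueCover G (C₁ G σ) (C₂ G σ)
    cc = C₁C₂-cliqueCover G σ ord

    S₁ S₂ : Subset n
    S₁ = proj₁ (proj₁ α₁-max)
    S₂ = proj₁ (proj₁ α₂-max)

    S₁-independent : IndependentIn G σ (C₁ G σ) S₁
    S₁-independent = proj₁ (proj₂ (proj₁ α₁-max))

    S₂-independent : IndependentIn G σ (C₂ G σ) S₂
    S₂-independent = proj₁ (proj₂ (proj₁ α₂-max))

    W : Subset n
    W = U ∪ (S₁ ∪ S₂)

    ∣W∣≡∣U∣+α₁+α₂ : ∣ W ∣ ≡ ∣ U ∣ + (α₁ + α₂)
    ∣W∣≡∣U∣+α₁+α₂ = trans
      (∣U∪S₁∪S₂∣≡∣U∣+∣S₁∣+∣S₂∣ G cc (proj₁ S₁-independent _) (proj₁ S₂-independent _))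
      (cong (∣ U ∣ +_) (cong₂ _+_ (proj₂ (proj₂ (proj₁ α₁-max))) (proj₂ (proj₂ (proj₁ α₂-max)))))

    vertex : 1 ≤ ∣ U ∣ + (α₁ + α₂) → Fin n
    vertex 1≤ = proj₁ (pick {p = W} (≤-trans 1≤ (≤-reflexive (sym ∣W∣≡∣U∣+α₁+α₂))))

    C₁-meets : α₁ ≤ 1 → ∀ {x y} → C₁ G σ x → C₁ G σ y → x ≢ y → CommonNonNeighbour G x y
    C₁-meets α₁≤1 = α≤1⇒commonNonNeighbour G σ (proj₂ α₁-max) α₁≤1

    C₂-meets : α₂ ≤ 1 → ∀ {x y} → C₂ G σ x → C₂ G σ y → x ≢ y → CommonNonNeighbour G x y
    C₂-meets α₂≤1 = α≤1⇒commonNonNeighbour G σ (proj₂ α₂-max) α₂≤1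

    classes : ∀ {x} → ¬ Universal G x → ∃ (C₁ G σ) × ∃ (C₂ G σ)
    classes = classes-inhabited G cc

    Dominating : Subset n → Set
    Dominating = IsKTupleDominating G 3

    dominating-of-W : 4 ≤ ∣ U ∣ + (α₁ + α₂) → ∃ λ D → Dominating D × ∣ D ∣ ≤ 4
    dominating-of-W 4≤ = dominating-subset G {W = W}
      (pairwiseDominating⇒missesAtMost1 G {W} (U∪S₁∪S₂-pairwiseDominating G cc (proj₁ S₁-independent _) (proj₁ S₂-independent _)
        (independent⇒pairwiseDominating G σ S₁-independent) (independent⇒pairwiseDominating G σ S₂-independent)))
      (≤-trans 4≤ (≤-reflexive (sym ∣W∣≡∣U∣+α₁+α₂)))

    ∣D∣≤∣U∣+∣C₁∩D∣+∣C₂∩D∣ : ∀ D → ∣ D ∣ ≤ ∣ U ∣ + (∣ setOf (C₁? G σ) ∩ D ∣ + ∣ setOf (C₂? G σ) ∩ D ∣)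
    ∣D∣≤∣U∣+∣C₁∩D∣+∣C₂∩D∣ = ∣D∣≤∣U∣+∣P∩D∣+∣Q∩D∣ G cc (C₁? G σ) (C₂? G σ)

    ∣D∣≤4⇒∣D∣≤∣U∣+α₁+α₂ : ∀ D → Dominating D → ∣ D ∣ ≤ 4 → ∣ D ∣ ≤ ∣ U ∣ + (α₁ + α₂)
    ∣D∣≤4⇒∣D∣≤∣U∣+α₁+α₂ D dom ∣D∣≤4 = ≤-trans (∣D∣≤∣U∣+∣C₁∩D∣+∣C₂∩D∣ D) (+-monoʳ-≤ ∣ U ∣ (+-mono-≤
      (proj₂ α₁-max _ (missesAtMost1⇒independent G σ (C₁? G σ) {D} misses))
      (proj₂ α₂-max _ (missesAtMost1⇒independent G σ (C₂? G σ) {D} misses))))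
      where
      misses : MissesAtMost G 1 D
      misses = dominating⇒missesAtMost G {D = D} dom ∣D∣≤4

    ∣D∣≤5⇒∣D∣≤∣U∣+4 : α₁ ≤ 1 → α₂ ≤ 1 → ∀ D → Dominating D → ∣ D ∣ ≤ 5 → ∣ D ∣ ≤ ∣ U ∣ + 4
    ∣D∣≤5⇒∣D∣≤∣U∣+4 α₁≤1 α₂≤1 D dom ∣D∣≤5 = ≤-trans (∣D∣≤∣U∣+∣C₁∩D∣+∣C₂∩D∣ D) (+-monoʳ-≤ ∣ U ∣ (+-mono-≤
      (missesAtMost2⇒∣C∩D∣≤2 G σ ord (C₁? G σ) (C₁-meets α₁≤1) {D} misses)
      (missesAtMost2⇒∣C∩D∣≤2 G σ ord (C₂? G σ) (C₂-meets α₂≤1) {D} misses)))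
      where
      misses : MissesAtMost G 2 D
      misses = dominating⇒missesAtMost G {D = D} dom ∣D∣≤5

    4≤∣D∣ : ∣ U ∣ ≤ 2 → Fin n → ∀ D → Dominating D → 4 ≤ ∣ D ∣
    4≤∣D∣ ∣U∣≤2 v D = ∣U∣<k⇒k<∣D∣ G v (s≤s ∣U∣≤2)

    5≤∣D∣ : ∣ U ∣ + (α₁ + α₂) ≤ 3 → ∣ U ∣ ≤ 2 → Fin n → ∀ D → Dominating D → 5 ≤ ∣ D ∣
    5≤∣D∣ small ∣U∣≤2 v D dom = ≤-refine (4≤∣D∣ ∣U∣≤2 v D dom) λ ∣D∣≤4 →
      s≤s (≤-trans (∣D∣≤4⇒∣D∣≤∣U∣+α₁+α₂ D dom ∣D∣≤4) small)

    universal-vertex : 1 ≤ ∣ U ∣ → ∃ (Universal G)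
    universal-vertex 1≤∣U∣ = let u , u∈U , _ = pick {p = U} 1≤∣U∣ in u , ∈universalSet⁻ G u∈U

    nonuniversal⇒1≤α : ∀ {x} → ¬ Universal G x → 1 ≤ α₁ × 1 ≤ α₂
    nonuniversal⇒1≤α ¬Uv = let (_ , Ca) , (_ , Cb) = classes ¬Uv in
      member⇒1≤α G σ (proj₂ α₁-max) Ca , member⇒1≤α G σ (proj₂ α₂-max) Cb

  γ×3-of-∣U∣≡1 : ∣ U ∣ ≡ 1 →
    (3 ≤ α₁ + α₂ → IsKTupleDomNumber G 3 4) × (α₁ + α₂ ≡ 2 → IsKTupleDomNumber G 3 5)
  γ×3-of-∣U∣≡1 ∣U∣≡1 =
    let u , Uu = universal-vertex (≤-reflexive (sym ∣U∣≡1))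
        (_ , Ca) , (_ , Cb) = classes (proj₂ (∣U∣≤2⇒nonuniversal G δ≥2 ∣U∣≤2 u))
    in (λ 3≤α → isKTupleDomNumber G (4≤∣D∣ ∣U∣≤2 u)
                  (dominating-of-W (subst (λ k → 4 ≤ k + _) (sym ∣U∣≡1) (s≤s 3≤α)))) ,
       (λ α≡2 → isKTupleDomNumber G (5≤∣D∣ (≤-reflexive (cong₂ _+_ ∣U∣≡1 α≡2)) ∣U∣≤2 u)
                  (dominating-u+2+2-from G cc δ≥2 (≤-reflexive ∣U∣≡1) Uu Ca Cb))
    where
    ∣U∣≤2 : ∣ U ∣ ≤ 2
    ∣U∣≤2 = ≤-trans (≤-reflexive ∣U∣≡1) (s≤s z≤n)

  γ×3-of-∣U∣≡2 : ∣ U ∣ ≡ 2 → IsKTupleDomNumber G 3 4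
  γ×3-of-∣U∣≡2 ∣U∣≡2 = isKTupleDomNumber G (4≤∣D∣ (≤-reflexive ∣U∣≡2) u) (dominating-of-W 4≤∣U∣+α₁+α₂)
    where
    u = proj₁ (universal-vertex (≤-trans (s≤s z≤n) (≤-reflexive (sym ∣U∣≡2))))
    1≤α = nonuniversal⇒1≤α (proj₂ (∣U∣≤2⇒nonuniversal G δ≥2 (≤-reflexive ∣U∣≡2) u))
    4≤∣U∣+α₁+α₂ : 4 ≤ ∣ U ∣ + (α₁ + α₂)
    4≤∣U∣+α₁+α₂ rewrite ∣U∣≡2 = s≤s (s≤s (+-mono-≤ (proj₁ 1≤α) (proj₂ 1≤α)))

  γ×3-of-3≤∣U∣ : 3 ≤ ∣ U ∣ → IsKTupleDomNumber G 3 3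
  γ×3-of-3≤∣U∣ 3≤∣U∣ = isKTupleDomNumber G (λ D → dominating⇒k≤∣D∣ G u)
    (dominating-subset G {W = U} (universalSet-missesAtMost0 G) 3≤∣U∣)
    where
    u = proj₁ (universal-vertex (≤-trans (s≤s z≤n) 3≤∣U∣))

  module _ (∣U∣≡0 : ∣ U ∣ ≡ 0) where

    private
      ∣U∣≤2 : ∣ U ∣ ≤ 2
      ∣U∣≤2 = ≤-trans (≤-reflexive ∣U∣≡0) z≤n

      vertex-of-α : 1 ≤ α₁ + α₂ → Fin n
      vertex-of-α 1≤α = vertex (subst (λ k → 1 ≤ k + _) (sym ∣U∣≡0) 1≤α)

    γ×3-of-4≤α : 4 ≤ α₁ + α₂ → IsKTupleDomNumber G 3 4
    γ×3-of-4≤α 4≤α = isKTupleDomNumber G (4≤∣D∣ ∣U∣≤2 (vertex-of-α (≤-trans (s≤s z≤n) 4≤α)))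
      (dominating-of-W (subst (λ k → 4 ≤ k + _) (sym ∣U∣≡0) 4≤α))

    γ×3-of-α₁≡α₂≡1 : α₁ ≡ 1 → α₂ ≡ 1 → IsKTupleDomNumber G 3 6
    γ×3-of-α₁≡α₂≡1 α₁≡1 α₂≡1 =
      let (_ , Ca) , (_ , Cb) = classes (∣U∣≡0⇒¬Universal G ∣U∣≡0 v)
      in isKTupleDomNumber G lower
           (dominating-3+3-from G cc δ≥2 ∣U∣≡0 (C₂-meets (≤-reflexive α₂≡1)) (C₁-meets (≤-reflexive α₁≡1)) Ca Cb)
      where
      v = vertex-of-α (≤-trans (s≤s z≤n) (≤-reflexive (sym (cong₂ _+_ α₁≡1 α₂≡1))))
      lower : ∀ D → Dominating D → 6 ≤ ∣ D ∣
      lower D dom = ≤-refine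
        (5≤∣D∣ (≤-trans (≤-reflexive (cong₂ _+_ ∣U∣≡0 (cong₂ _+_ α₁≡1 α₂≡1))) (s≤s (s≤s z≤n))) ∣U∣≤2 v D dom)
        λ ∣D∣≤5 → s≤s (≤-trans (∣D∣≤5⇒∣D∣≤∣U∣+4 (≤-reflexive α₁≡1) (≤-reflexive α₂≡1) D dom ∣D∣≤5)
                                (≤-reflexive (cong (_+ 4) ∣U∣≡0)))

    γ×3-of-α₁+α₂≡3 : α₁ + α₂ ≡ 3 → IsKTupleDomNumber G 3 5
    γ×3-of-α₁+α₂≡3 α≡3 = isKTupleDomNumber G (5≤∣D∣ (≤-reflexive (cong₂ _+_ ∣U∣≡0 α≡3)) ∣U∣≤2 v)
      (upper (split-3 α≡3 (proj₁ 1≤α) (proj₂ 1≤α)))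
      where
      v = vertex-of-α (≤-trans (s≤s z≤n) (≤-reflexive (sym α≡3)))
      ¬Uv = ∣U∣≡0⇒¬Universal G ∣U∣≡0 v
      1≤α = nonuniversal⇒1≤α ¬Uv
      upper : (2 ≤ α₁ × α₂ ≤ 1) ⊎ (α₁ ≤ 1 × 2 ≤ α₂) → ∃ λ D → Dominating D × ∣ D ∣ ≤ 5
      upper (inj₁ (2≤α₁ , α₂≤1)) =
        let a , a' , Ca , Ca' , a≢a' , aa' = 2≤α⇒dominatingPair G σ α₁-max 2≤α₁
            _ , Cb = proj₂ (classes ¬Uv)
        in dominating-3+2-from G cc δ≥2 ∣U∣≡0 (C₂-meets α₂≤1) Ca Ca' a≢a' aa' Cb
      upper (inj₂ (α₁≤1 , 2≤α₂)) =
        let b , b' , Cb , Cb' , b≢b' , bb' = 2≤α⇒dominatingPair G σ α₂-max 2≤α₂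
            _ , Ca = proj₁ (classes ¬Uv)
        in dominating-3+2-from G (swap G cc) δ≥2 ∣U∣≡0 (C₁-meets α₁≤1) Cb Cb' b≢b' bb' Ca

theorem4p8 : ∀ {n} (G : Graph n) → Connected G → MinDegree≥ G 2 → IsCoBiconvex G →
  (σ : Permutation′ n) → CoBiconvexOrderingMinusU G σ →
  (α₁ α₂ : ℕ) →
  IsIndependenceNumber G σ (C₁ G σ) α₁ → IsIndependenceNumber G σ (C₂ G σ) α₂ →
  ((∣ universalSet G ∣ ≡ 1 →
      (3 ≤ α₁ + α₂ → IsKTupleDomNumber G 3 4) × (α₁ + α₂ ≡ 2 → IsKTupleDomNumber G 3 5)) ×
   (∣ universalSet G ∣ ≡ 2 → IsKTupleDomNumber G 3 4) ×
   (3 ≤ ∣ universalSet G ∣ → IsKTupleDomNumber G 3 3) ×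
   (∣ universalSet G ∣ ≡ 0 → 4 ≤ α₁ + α₂ → IsKTupleDomNumber G 3 4) ×
   (∣ universalSet G ∣ ≡ 0 → α₁ ≡ 1 → α₂ ≡ 1 → IsKTupleDomNumber G 3 6) ×
   (∣ universalSet G ∣ ≡ 0 → α₁ + α₂ ≡ 3 → IsKTupleDomNumber G 3 5))
theorem4p8 G _ δ≥2 _ σ ord α₁ α₂ α₁-max α₂-max =
  γ×3-of-∣U∣≡1 , γ×3-of-∣U∣≡2 , γ×3-of-3≤∣U∣ , γ×3-of-4≤α , γ×3-of-α₁≡α₂≡1 , γ×3-of-α₁+α₂≡3
  where open Cases G δ≥2 σ ord α₁-max α₂-max
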